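{- For any two integers $q\ge 0$, $k\ge 0$, $$\sum_{n=q}^{\infty} \left[\begin{matrix} n \\ q \end{matrix}\right] \frac{1}{n!\,(n+1)^{k+1}} = \sum_{n=k}^{\infty} \left[\begin{matrix} n \\ k \end{matrix}\right] \frac{1}{n!\,(n+1)^{q+1}}.$$
   Context: $\left[\begin{matrix} n \\ k \end{matrix}\right]$ is the unsigned Stirling number of the first kind, defined by $\frac{(-1)^k}{k!}\ln^k(1-x)=\sum_{n\ge k}\left[\begin{matrix} n \\ k \end{matrix}\right]\frac{x^n}{n!}$ ($|x|<1$); in particular $\left[\begin{matrix} 0 \\ 0 \end{matrix}\right]=1$ and $\left[\begin{matrix} n \\ 0 \end{matrix}\right]=0$ for $n\ge1$. -}

module Defs where

open import Data.Nat as ℕ using (ℕ; zero; suc; _!; _^_; _∸_)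
open import Data.Nat.Properties using (_!≢0; m^n≢0)
open import Data.Integer using (+_)
open import Data.Rational using (ℚ; 0ℚ; 1ℚ; _+_; _*_; _-_; _/_; ∣_∣; _<_; _≤_)

Σ< : ℕ → (ℕ → ℚ) → ℚ
Σ< zero    f = 0ℚ
Σ< (suc n) f = Σ< n f + f n

FPS : Set
FPS = ℕ → ℚ

_⊛_ : FPS → FPS → FPS
(f ⊛ g) n = Σ< (suc n) (λ i → f i * g (n ∸ i))

one : FPS
one zero    = 1ℚ
one (suc n) = 0ℚ

_^ₛ_ : FPS → ℕ → FPS
f ^ₛ zero  = one
f ^ₛ suc k = f ⊛ (f ^ₛ k)

-- -ln(1-x) = Σ_{m≥1} x^m / m
negLog1m : FPS
negLog1m zero    = 0ℚ
negLog1m (suc m) = (+ 1) / suc m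

inv! : ℕ → ℚ
inv! n = _/_ (+ 1) (n !) {{n !≢0}}

-- Unsigned Stirling number of the first kind [n k], defined (as in the paper)
-- by (-1)^k/k! ln^k(1-x) = (-ln(1-x))^k / k! = Σ_n [n k] x^n / n!,
-- i.e. [n k] = n! * [x^n] ((-ln(1-x))^k / k!).
stirling1 : ℕ → ℕ → ℚ
stirling1 n k = (+ (n !) / 1) * (inv! k * (negLog1m ^ₛ k) n)

term : ℕ → ℕ → ℕ → ℚ
term q k n = stirling1 n q * (inv! n * _/_ (+ 1) (suc n ^ suc k) {{m^n≢0 (suc n) (suc k)}})

partial : ℕ → ℕ → ℕ → ℚ
partial q k N = Σ< N (λ i → term q k (q ℕ.+ i))

Cauchy : (ℕ → ℚ) → Set
Cauchy s = ∀ (ε : ℚ) → 0ℚ < ε → Σ ℕ λ M → ∀ m n → M ℕ.≤ m → M ℕ.≤ n → ∣ s m - s n ∣ < ε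
  where open import Data.Product using (Σ)

SameLimit : (ℕ → ℚ) → (ℕ → ℚ) → Set
SameLimit s t = ∀ (ε : ℚ) → 0ℚ < ε → Σ ℕ λ M → ∀ n → M ℕ.≤ n → ∣ s n - t n ∣ < ε
  where open import Data.Product using (Σ)

-- With a q n = [n q] / n!, the coefficient of xⁿ in (−ln(1 − x))^q / q!, and B the Beta function,
--   Σₘ a k m B(n + 1, m + 1) = ∫₀¹ (1 − x)ⁿ (−ln(1 − x))ᵏ / k! dx = 1 / (n + 1)^(k + 1),
-- so both series equal the symmetric double sum Σₙ Σₘ a q n a k m B(n + 1, m + 1).
-- Everything is done with truncations and uses only the recurrence
-- (n + 1) a (q + 1) (n + 1) = n a (q + 1) n + a q n, obtained from (1 − x) (−ln(1 − x))′ = 1.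
-- The remainder of the inner sum after M terms is nonnegative and at most G k M / (n + 1),
-- where G k M = Σ_{j ≤ k} a j M; the same G bounds the tails of both series, and
-- G k M ≤ 2^(k + 1) (2M choose M) / 4^M ≤ 2^(k + 1) / √(2M + 1) gives explicit rates.

module Submission where

open import Defs
open import Data.Nat.Base as ℕ using (ℕ; zero; suc; _∸_; _!; _^_; z≤n; s≤s)
import Data.Nat.Properties as ℕ
open import Data.Nat.Properties using (_!≢0; m^n≢0)
open import Data.Nat.Divisibility using (_∣_; ∣⇒≤)
open import Data.Nat.Combinatorics using (k![n∸k]!∣n!)
import Data.Nat.Tactic.RingSolver as ℕ-Solver
open import Data.Integer.Base as ℤ using (+[1+_]; -[1+_])
import Data.Integer.Properties as ℤ
open import Data.Rational.Base as ℚ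
  using (ℚ; 0ℚ; 1ℚ; _+_; _*_; _-_; -_; _/_; _≤_; _<_; ∣_∣; mkℚ; toℚᵘ)
open import Data.Rational.Properties
import Data.Rational.Unnormalised.Base as ℚᵘ
import Data.Rational.Unnormalised.Properties as ℚᵘ
open import Data.Product.Base using (Σ; _,_; _×_; proj₁; proj₂)
open import Data.Sum.Base using (inj₁; inj₂)
open import Relation.Nullary.Decidable.Core using (yes; no; dec⇒maybe)
open import Relation.Nullary.Negation.Core using (contradiction)
open import Relation.Binary.PropositionalEquality
open import Tactic.RingSolver using (solve-∀)
open import Tactic.RingSolver.Core.AlmostCommutativeRing
  using (AlmostCommutativeRing; fromCommutativeRing)

ℚ-ring : AlmostCommutativeRing _ _
ℚ-ring = fromCommutativeRing +-*-commutativeRing (λ x → dec⇒maybe (0ℚ ≟ x))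

ι : ℕ → ℚ
ι n = ℤ.+ n / 1

recip : (d : ℕ) .{{_ : ℕ.NonZero d}} → ℚ
recip d = ℤ.+ 1 / d

toℚᵘ-ι : ∀ n → toℚᵘ (ι n) ℚᵘ.≃ ℚᵘ.mkℚᵘ (ℤ.+ n) 0
toℚᵘ-ι n = toℚᵘ-fromℚᵘ (ℚᵘ.mkℚᵘ (ℤ.+ n) 0)

ι-+ : ∀ m n → ι (m ℕ.+ n) ≡ ι m + ι n
ι-+ m n = toℚᵘ-injective (ℚᵘ.≃-trans (toℚᵘ-ι (m ℕ.+ n)) (ℚᵘ.≃-trans (ℚᵘ.*≡* eq)
  (ℚᵘ.≃-sym (ℚᵘ.≃-trans (toℚᵘ-homo-+ (ι m) (ι n)) (ℚᵘ.+-cong (toℚᵘ-ι m) (toℚᵘ-ι n))))))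
  where
  eq : ℤ.+ (m ℕ.+ n) ℤ.* ℤ.+ 1 ≡ (ℤ.+ m ℤ.* ℤ.+ 1 ℤ.+ ℤ.+ n ℤ.* ℤ.+ 1) ℤ.* ℤ.+ 1
  eq rewrite ℤ.*-identityʳ (ℤ.+ m) | ℤ.*-identityʳ (ℤ.+ n) | ℤ.*-identityʳ (ℤ.+ m ℤ.+ ℤ.+ n)
    = sym (ℤ.pos-+ m n)

ι-* : ∀ m n → ι (m ℕ.* n) ≡ ι m * ι n
ι-* m n = toℚᵘ-injective (ℚᵘ.≃-trans (toℚᵘ-ι (m ℕ.* n)) (ℚᵘ.≃-trans (ℚᵘ.*≡* eq)
  (ℚᵘ.≃-sym (ℚᵘ.≃-trans (toℚᵘ-homo-* (ι m) (ι n)) (ℚᵘ.*-cong (toℚᵘ-ι m) (toℚᵘ-ι n))))))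
  where
  eq : ℤ.+ (m ℕ.* n) ℤ.* ℤ.+ 1 ≡ (ℤ.+ m ℤ.* ℤ.+ n) ℤ.* ℤ.+ 1
  eq rewrite ℤ.*-identityʳ (ℤ.+ m ℤ.* ℤ.+ n) | ℤ.*-identityʳ (ℤ.+ (m ℕ.* n))
    = sym (ℤ.+◃n≡+n (m ℕ.* n))

ι-suc : ∀ n → ι (suc n) ≡ 1ℚ + ι n
ι-suc = ι-+ 1

/-*-cancel : ∀ a d → (ℤ.+ a / suc d) * ι (suc d) ≡ ι a
/-*-cancel a d = toℚᵘ-injective (ℚᵘ.≃-trans (toℚᵘ-homo-* (ℤ.+ a / suc d) (ι (suc d)))
  (ℚᵘ.≃-trans (ℚᵘ.*-cong (toℚᵘ-fromℚᵘ (ℚᵘ.mkℚᵘ (ℤ.+ a) d)) (toℚᵘ-ι (suc d)))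
    (ℚᵘ.≃-trans (ℚᵘ.*≡* eq) (ℚᵘ.≃-sym (toℚᵘ-ι a)))))
  where
  eq : (ℤ.+ a ℤ.* ℤ.+ suc d) ℤ.* ℤ.+ 1 ≡ ℤ.+ a ℤ.* ℤ.+ (suc d ℕ.* 1)
  eq rewrite ℤ.*-identityʳ (ℤ.+ a ℤ.* ℤ.+ suc d) | ℕ.*-identityʳ (suc d) = refl

ι-≥0 : ∀ n → 0ℚ ≤ ι n
ι-≥0 n = nonNegative⁻¹ (ι n) {{normalize-nonNeg n 1}}

ι-suc->0 : ∀ n → 0ℚ < ι (suc n)
ι-suc->0 n = positive⁻¹ (ι (suc n)) {{normalize-pos (suc n) 1}}

ι-mono-≤ : ∀ {m n} → m ℕ.≤ n → ι m ≤ ι n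
ι-mono-≤ {m} {n} m≤n = begin
  ι m                ≡⟨ +-identityʳ (ι m) ⟨
  ι m + 0ℚ           ≤⟨ +-monoʳ-≤ (ι m) (ι-≥0 (n ∸ m)) ⟩
  ι m + ι (n ∸ m)    ≡⟨ ι-+ m (n ∸ m) ⟨
  ι (m ℕ.+ (n ∸ m))  ≡⟨ cong ι (ℕ.m+[n∸m]≡n m≤n) ⟩
  ι n                ∎
  where open ≤-Reasoning

ι[1+n]-*-cancelˡ-≤ : ∀ n {x y} → ι (suc n) * x ≤ ι (suc n) * y → x ≤ y
ι[1+n]-*-cancelˡ-≤ n = *-cancelˡ-≤-pos (ι (suc n)) {{ℚ.positive (ι-suc->0 n)}}

ι[1+n]-*-cancelˡ-≡ : ∀ n {x y} → ι (suc n) * x ≡ ι (suc n) * y → x ≡ y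
ι[1+n]-*-cancelˡ-≡ n eq = ≤-antisym (ι[1+n]-*-cancelˡ-≤ n (≤-reflexive eq))
                                    (ι[1+n]-*-cancelˡ-≤ n (≤-reflexive (sym eq)))

*-monoˡ-≤-≥0 : ∀ {p q} c → 0ℚ ≤ c → p ≤ q → c * p ≤ c * q
*-monoˡ-≤-≥0 c 0≤c = *-monoˡ-≤-nonNeg c {{ℚ.nonNegative 0≤c}}

*-monoʳ-≤-≥0 : ∀ {p q} c → 0ℚ ≤ c → p ≤ q → p * c ≤ q * c
*-monoʳ-≤-≥0 c 0≤c = *-monoʳ-≤-nonNeg c {{ℚ.nonNegative 0≤c}}

*-mono-≤-≥0 : ∀ {p q u v} → 0ℚ ≤ q → 0ℚ ≤ u → p ≤ q → u ≤ v → p * u ≤ q * v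
*-mono-≤-≥0 {q = q} {u} 0≤q 0≤u p≤q u≤v =
  ≤-trans (*-monoʳ-≤-≥0 u 0≤u p≤q) (*-monoˡ-≤-≥0 q 0≤q u≤v)

*-≥0 : ∀ {p q} → 0ℚ ≤ p → 0ℚ ≤ q → 0ℚ ≤ p * q
*-≥0 {p} {q} 0≤p 0≤q = nonNegative⁻¹ (p * q)
  {{nonNeg*nonNeg⇒nonNeg p {{ℚ.nonNegative 0≤p}} q {{ℚ.nonNegative 0≤q}}}}

+-≥0 : ∀ {p q} → 0ℚ ≤ p → 0ℚ ≤ q → 0ℚ ≤ p + q
+-≥0 0≤p 0≤q = +-mono-≤ 0≤p 0≤q

p≤p+q : ∀ p {q} → 0ℚ ≤ q → p ≤ p + q
p≤p+q p 0≤q = ≤-trans (≤-reflexive (sym (+-identityʳ p))) (+-monoʳ-≤ p 0≤q)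

recip-inverseˡ : ∀ d .{{_ : ℕ.NonZero d}} → recip d * ι d ≡ 1ℚ
recip-inverseˡ (suc d) = /-*-cancel 1 d

recip-inverseʳ : ∀ d .{{_ : ℕ.NonZero d}} → ι d * recip d ≡ 1ℚ
recip-inverseʳ d = trans (*-comm (ι d) (recip d)) (recip-inverseˡ d)

recip-unique : ∀ d .{{_ : ℕ.NonZero d}} {x} → x * ι d ≡ 1ℚ → x ≡ recip d
recip-unique d {x} x*d≡1 = begin
  x                     ≡⟨ *-identityʳ x ⟨
  x * 1ℚ                ≡⟨ cong (x *_) (recip-inverseʳ d) ⟨
  x * (ι d * recip d)   ≡⟨ *-assoc x (ι d) (recip d) ⟨
  (x * ι d) * recip d   ≡⟨ cong (_* recip d) x*d≡1 ⟩
  1ℚ * recip d          ≡⟨ *-identityˡ (recip d) ⟩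
  recip d               ∎
  where open ≡-Reasoning

recip-≥0 : ∀ d .{{_ : ℕ.NonZero d}} → 0ℚ ≤ recip d
recip-≥0 d = nonNegative⁻¹ (recip d) {{normalize-nonNeg 1 d}}

recip-antimono-≤ : ∀ {d e} .{{_ : ℕ.NonZero d}} .{{_ : ℕ.NonZero e}} →
                   d ℕ.≤ e → recip e ≤ recip d
recip-antimono-≤ {d} {e} d≤e = begin
  recip e                      ≡⟨ *-identityˡ (recip e) ⟨
  1ℚ * recip e                 ≡⟨ cong (_* recip e) (recip-inverseˡ d) ⟨
  (recip d * ι d) * recip e    ≤⟨ *-monoʳ-≤-≥0 (recip e) (recip-≥0 e)
                                    (*-monoˡ-≤-≥0 (recip d) (recip-≥0 d) (ι-mono-≤ d≤e)) ⟩
  (recip d * ι e) * recip e    ≡⟨ *-assoc (recip d) (ι e) (recip e) ⟩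
  recip d * (ι e * recip e)    ≡⟨ cong (recip d *_) (recip-inverseʳ e) ⟩
  recip d * 1ℚ                 ≡⟨ *-identityʳ (recip d) ⟩
  recip d                      ∎
  where open ≤-Reasoning

recip-suc-≤1 : ∀ n → recip (suc n) ≤ 1ℚ
recip-suc-≤1 n = recip-antimono-≤ {1} {suc n} (s≤s z≤n)

Σ<-cong : ∀ n {f g : ℕ → ℚ} → (∀ i → i ℕ.< n → f i ≡ g i) → Σ< n f ≡ Σ< n g
Σ<-cong zero    eq = refl
Σ<-cong (suc n) eq = cong₂ _+_ (Σ<-cong n (λ i i<n → eq i (ℕ.m<n⇒m<1+n i<n))) (eq n ℕ.≤-refl)

Σ<-ext : ∀ n {f g : ℕ → ℚ} → (∀ i → f i ≡ g i) → Σ< n f ≡ Σ< n g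
Σ<-ext n eq = Σ<-cong n (λ i _ → eq i)

Σ<-≡0 : ∀ n {f : ℕ → ℚ} → (∀ i → i ℕ.< n → f i ≡ 0ℚ) → Σ< n f ≡ 0ℚ
Σ<-≡0 zero    eq = refl
Σ<-≡0 (suc n) eq = cong₂ _+_ (Σ<-≡0 n (λ i i<n → eq i (ℕ.m<n⇒m<1+n i<n))) (eq n ℕ.≤-refl)

Σ<-+ : ∀ n (f g : ℕ → ℚ) → Σ< n (λ i → f i + g i) ≡ Σ< n f + Σ< n g
Σ<-+ zero    f g = refl
Σ<-+ (suc n) f g = trans (cong (_+ (f n + g n)) (Σ<-+ n f g)) (lem (Σ< n f) (Σ< n g) (f n) (g n))
  where lem : ∀ a b c d → (a + b) + (c + d) ≡ (a + c) + (b + d)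
        lem = solve-∀ ℚ-ring

Σ<-- : ∀ n (f g : ℕ → ℚ) → Σ< n (λ i → f i - g i) ≡ Σ< n f - Σ< n g
Σ<-- zero    f g = refl
Σ<-- (suc n) f g = trans (cong (_+ (f n - g n)) (Σ<-- n f g)) (lem (Σ< n f) (Σ< n g) (f n) (g n))
  where lem : ∀ a b c d → (a - b) + (c - d) ≡ (a + c) - (b + d)
        lem = solve-∀ ℚ-ring

*-distribˡ-Σ< : ∀ n c (f : ℕ → ℚ) → c * Σ< n f ≡ Σ< n (λ i → c * f i)
*-distribˡ-Σ< zero    c f = *-zeroʳ c
*-distribˡ-Σ< (suc n) c f =
  trans (*-distribˡ-+ c (Σ< n f) (f n)) (cong (_+ c * f n) (*-distribˡ-Σ< n c f))

Σ<-suc : ∀ n (f : ℕ → ℚ) → Σ< (suc n) f ≡ f 0 + Σ< n (λ i → f (suc i))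
Σ<-suc zero    f = +-comm 0ℚ (f 0)
Σ<-suc (suc n) f = trans (cong (_+ f (suc n)) (Σ<-suc n f)) (+-assoc (f 0) _ _)

Σ<-split : ∀ m n (f : ℕ → ℚ) → Σ< (m ℕ.+ n) f ≡ Σ< m f + Σ< n (λ i → f (m ℕ.+ i))
Σ<-split m zero    f = trans (cong (λ k → Σ< k f) (ℕ.+-identityʳ m)) (sym (+-identityʳ _))
Σ<-split m (suc n) f = begin
  Σ< (m ℕ.+ suc n) f                                  ≡⟨ cong (λ k → Σ< k f) (ℕ.+-suc m n) ⟩
  Σ< (m ℕ.+ n) f + f (m ℕ.+ n)                        ≡⟨ cong (_+ f (m ℕ.+ n)) (Σ<-split m n f) ⟩
  (Σ< m f + Σ< n (λ i → f (m ℕ.+ i))) + f (m ℕ.+ n)   ≡⟨ +-assoc (Σ< m f) _ _ ⟩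
  Σ< m f + Σ< (suc n) (λ i → f (m ℕ.+ i))             ∎
  where open ≡-Reasoning

Σ<-comm : ∀ n m (f : ℕ → ℕ → ℚ) →
          Σ< n (λ i → Σ< m (λ j → f i j)) ≡ Σ< m (λ j → Σ< n (λ i → f i j))
Σ<-comm zero    m f = sym (Σ<-≡0 m (λ _ _ → refl))
Σ<-comm (suc n) m f = begin
  Σ< n (λ i → Σ< m (f i)) + Σ< m (f n)          ≡⟨ cong (_+ Σ< m (f n)) (Σ<-comm n m f) ⟩
  Σ< m (λ j → Σ< n (λ i → f i j)) + Σ< m (f n)  ≡⟨ Σ<-+ m _ _ ⟨
  Σ< m (λ j → Σ< n (λ i → f i j) + f n j)       ∎
  where open ≡-Reasoning

Σ<-mono-≤ : ∀ n {f g : ℕ → ℚ} → (∀ i → i ℕ.< n → f i ≤ g i) → Σ< n f ≤ Σ< n g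
Σ<-mono-≤ zero    f≤g = ≤-refl
Σ<-mono-≤ (suc n) f≤g =
  +-mono-≤ (Σ<-mono-≤ n (λ i i<n → f≤g i (ℕ.m<n⇒m<1+n i<n))) (f≤g n ℕ.≤-refl)

Σ<-≥0 : ∀ n {f : ℕ → ℚ} → (∀ i → i ℕ.< n → 0ℚ ≤ f i) → 0ℚ ≤ Σ< n f
Σ<-≥0 n {f} 0≤f = ≤-trans (≤-reflexive (sym (Σ<-≡0 n {λ _ → 0ℚ} (λ _ _ → refl)))) (Σ<-mono-≤ n 0≤f)

_⊖_ : FPS → FPS → FPS
(f ⊖ g) n = f n - g n

-- Coefficients of f′, of x f′ and of (1 − x) f′.
deriv euler ∂ : FPS → FPS
deriv f n = ι (suc n) * f (suc n)
euler f n = ι n * f n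
∂ f = deriv f ⊖ euler f

⊛-congˡ : ∀ {f h} g n → (∀ i → f i ≡ h i) → (f ⊛ g) n ≡ (h ⊛ g) n
⊛-congˡ g n eq = Σ<-ext (suc n) (λ i → cong (_* g (n ∸ i)) (eq i))

⊛-congʳ : ∀ f {g h} n → (∀ i → g i ≡ h i) → (f ⊛ g) n ≡ (f ⊛ h) n
⊛-congʳ f n eq = Σ<-ext (suc n) (λ i → cong (f i *_) (eq (n ∸ i)))

⊛-identityˡ : ∀ f n → (one ⊛ f) n ≡ f n
⊛-identityˡ f n = begin
  (one ⊛ f) n                                    ≡⟨ Σ<-suc n _ ⟩
  1ℚ * f n + Σ< n (λ i → 0ℚ * f (n ∸ suc i))     ≡⟨ cong₂ _+_ (*-identityˡ (f n))
                                                      (Σ<-≡0 n (λ i _ → *-zeroˡ (f (n ∸ suc i)))) ⟩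
  f n + 0ℚ                                       ≡⟨ +-identityʳ (f n) ⟩
  f n                                            ∎
  where open ≡-Reasoning

⊛-*ʳ : ∀ f g c n → (f ⊛ (λ i → c * g i)) n ≡ c * (f ⊛ g) n
⊛-*ʳ f g c n = trans (Σ<-ext (suc n) (λ i → lem (f i) c (g (n ∸ i)))) (sym (*-distribˡ-Σ< (suc n) c _))
  where lem : ∀ x c y → x * (c * y) ≡ c * (x * y)
        lem = solve-∀ ℚ-ring

⊛-distribʳ-⊖ : ∀ f h g n → ((f ⊖ h) ⊛ g) n ≡ (f ⊛ g) n - (h ⊛ g) n
⊛-distribʳ-⊖ f h g n = trans (Σ<-ext (suc n) (λ i → lem (f i) (h i) (g (n ∸ i)))) (Σ<-- (suc n) _ _)
  where lem : ∀ a b c → (a - b) * c ≡ a * c - b * c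
        lem = solve-∀ ℚ-ring

⊛-distribˡ-⊖ : ∀ f g h n → (f ⊛ (g ⊖ h)) n ≡ (f ⊛ g) n - (f ⊛ h) n
⊛-distribˡ-⊖ f g h n = trans (Σ<-ext (suc n) (λ i → lem (f i) (g (n ∸ i)) (h (n ∸ i)))) (Σ<-- (suc n) _ _)
  where lem : ∀ a b c → a * (b - c) ≡ a * b - a * c
        lem = solve-∀ ℚ-ring

euler-⊛ : ∀ f g n → euler (f ⊛ g) n ≡ (euler f ⊛ g) n + (f ⊛ euler g) n
euler-⊛ f g n = begin
  ι n * Σ< (suc n) (λ i → f i * g (n ∸ i))            ≡⟨ *-distribˡ-Σ< (suc n) (ι n) _ ⟩
  Σ< (suc n) (λ i → ι n * (f i * g (n ∸ i)))          ≡⟨ Σ<-cong (suc n) split ⟩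
  Σ< (suc n) (λ i → (ι i * f i) * g (n ∸ i) + f i * (ι (n ∸ i) * g (n ∸ i)))
                                                      ≡⟨ Σ<-+ (suc n) _ _ ⟩
  (euler f ⊛ g) n + (f ⊛ euler g) n                   ∎
  where
  open ≡-Reasoning
  lem : ∀ a b x y → (a + b) * (x * y) ≡ (a * x) * y + x * (b * y)
  lem = solve-∀ ℚ-ring
  split : ∀ i → i ℕ.< suc n →
          ι n * (f i * g (n ∸ i)) ≡ (ι i * f i) * g (n ∸ i) + f i * (ι (n ∸ i) * g (n ∸ i))
  split i i<1+n = begin
    ι n * (f i * g (n ∸ i))                ≡⟨ cong (λ m → ι m * (f i * g (n ∸ i))) i+[n∸i]≡n ⟨
    ι (i ℕ.+ (n ∸ i)) * (f i * g (n ∸ i))  ≡⟨ cong (_* (f i * g (n ∸ i))) (ι-+ i (n ∸ i)) ⟩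
    (ι i + ι (n ∸ i)) * (f i * g (n ∸ i))  ≡⟨ lem (ι i) (ι (n ∸ i)) (f i) (g (n ∸ i)) ⟩
    (ι i * f i) * g (n ∸ i) + f i * (ι (n ∸ i) * g (n ∸ i)) ∎
    where i+[n∸i]≡n = ℕ.m+[n∸m]≡n (ℕ.s≤s⁻¹ i<1+n)

euler-⊛-suc : ∀ f g n → (euler f ⊛ g) (suc n) ≡ (deriv f ⊛ g) n
euler-⊛-suc f g n = begin
  (euler f ⊛ g) (suc n)                         ≡⟨ Σ<-suc (suc n) _ ⟩
  (0ℚ * f 0) * g (suc n) + (deriv f ⊛ g) n      ≡⟨ cong (_+ (deriv f ⊛ g) n) (trans
                                                     (cong (_* g (suc n)) (*-zeroˡ (f 0))) (*-zeroˡ (g (suc n)))) ⟩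
  0ℚ + (deriv f ⊛ g) n                          ≡⟨ +-identityˡ _ ⟩
  (deriv f ⊛ g) n                               ∎
  where open ≡-Reasoning

⊛-euler-suc : ∀ f g n → (f ⊛ euler g) (suc n) ≡ (f ⊛ deriv g) n
⊛-euler-suc f g n = trans (cong₂ _+_ (Σ<-cong (suc n) shift) last) (+-identityʳ _)
  where
  shift : ∀ i → i ℕ.< suc n →
          f i * (ι (suc n ∸ i) * g (suc n ∸ i)) ≡ f i * (ι (suc (n ∸ i)) * g (suc (n ∸ i)))
  shift i i<1+n = cong (λ m → f i * (ι m * g m)) (ℕ.+-∸-assoc 1 (ℕ.s≤s⁻¹ i<1+n))
  last : f (suc n) * (ι (n ∸ n) * g (n ∸ n)) ≡ 0ℚ
  last rewrite ℕ.n∸n≡0 n = trans (cong (f (suc n) *_) (*-zeroˡ (g 0))) (*-zeroʳ (f (suc n)))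

∂-⊛ : ∀ f g n → ∂ (f ⊛ g) n ≡ (∂ f ⊛ g) n + (f ⊛ ∂ g) n
∂-⊛ f g n = begin
  euler (f ⊛ g) (suc n) - euler (f ⊛ g) n
    ≡⟨ cong₂ _-_ (euler-⊛ f g (suc n)) (euler-⊛ f g n) ⟩
  ((euler f ⊛ g) (suc n) + (f ⊛ euler g) (suc n)) - ((euler f ⊛ g) n + (f ⊛ euler g) n)
    ≡⟨ cong₂ (λ u v → (u + v) - ((euler f ⊛ g) n + (f ⊛ euler g) n))
             (euler-⊛-suc f g n) (⊛-euler-suc f g n) ⟩
  ((deriv f ⊛ g) n + (f ⊛ deriv g) n) - ((euler f ⊛ g) n + (f ⊛ euler g) n)
    ≡⟨ lem ((deriv f ⊛ g) n) ((f ⊛ deriv g) n) ((euler f ⊛ g) n) ((f ⊛ euler g) n) ⟩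
  ((deriv f ⊛ g) n - (euler f ⊛ g) n) + ((f ⊛ deriv g) n - (f ⊛ euler g) n)
    ≡⟨ cong₂ _+_ (⊛-distribʳ-⊖ (deriv f) (euler f) g n) (⊛-distribˡ-⊖ f (deriv g) (euler g) n) ⟨
  (∂ f ⊛ g) n + (f ⊛ ∂ g) n
    ∎
  where
  open ≡-Reasoning
  lem : ∀ a b c d → (a + b) - (c + d) ≡ (a - c) + (b - d)
  lem = solve-∀ ℚ-ring

∂-one : ∀ n → ∂ one n ≡ 0ℚ
∂-one zero    = refl
∂-one (suc n) = cong₂ _-_ (*-zeroʳ (ι (suc (suc n)))) (*-zeroʳ (ι (suc n)))

∂-negLog1m : ∀ n → ∂ negLog1m n ≡ one n
∂-negLog1m zero    = refl
∂-negLog1m (suc m) =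
  trans (cong₂ _-_ (recip-inverseʳ (suc (suc m))) (recip-inverseʳ (suc m))) (+-inverseʳ 1ℚ)

mutual
  ∂-negLog1m^suc : ∀ q n → ∂ (negLog1m ^ₛ suc q) n ≡ ι (suc q) * (negLog1m ^ₛ q) n
  ∂-negLog1m^suc q n = begin
    ∂ (negLog1m ⊛ L^q) n                               ≡⟨ ∂-⊛ negLog1m L^q n ⟩
    (∂ negLog1m ⊛ L^q) n + (negLog1m ⊛ ∂ L^q) n        ≡⟨ cong₂ _+_ ∂negLog1m⊛L^q (negLog1m⊛∂negLog1m^ q n) ⟩
    L^q n + ι q * L^q n                                ≡⟨ lem (L^q n) (ι q) ⟩
    (1ℚ + ι q) * L^q n                                 ≡⟨ cong (_* L^q n) (ι-suc q) ⟨
    ι (suc q) * L^q n                                  ∎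
    where
    open ≡-Reasoning
    L^q = negLog1m ^ₛ q
    ∂negLog1m⊛L^q = trans (⊛-congˡ L^q n ∂-negLog1m) (⊛-identityˡ L^q n)
    lem : ∀ x y → x + y * x ≡ (1ℚ + y) * x
    lem = solve-∀ ℚ-ring

  negLog1m⊛∂negLog1m^ : ∀ q n → (negLog1m ⊛ ∂ (negLog1m ^ₛ q)) n ≡ ι q * (negLog1m ^ₛ q) n
  negLog1m⊛∂negLog1m^ zero n = begin
    (negLog1m ⊛ ∂ one) n          ≡⟨ ⊛-congʳ negLog1m n ∂-one ⟩
    (negLog1m ⊛ (λ _ → 0ℚ)) n     ≡⟨ Σ<-≡0 (suc n) (λ i _ → *-zeroʳ (negLog1m i)) ⟩
    0ℚ                            ≡⟨ *-zeroˡ (one n) ⟨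
    0ℚ * one n                    ∎
    where open ≡-Reasoning
  negLog1m⊛∂negLog1m^ (suc q) n =
    trans (⊛-congʳ negLog1m n (∂-negLog1m^suc q)) (⊛-*ʳ negLog1m (negLog1m ^ₛ q) (ι (suc q)) n)

a : ℕ → ℕ → ℚ
a q n = inv! q * (negLog1m ^ₛ q) n

ι[n!]*inv!≡1 : ∀ n → ι (n !) * inv! n ≡ 1ℚ
ι[n!]*inv!≡1 n = recip-inverseʳ (n !) {{n !≢0}}

inv!-suc : ∀ q → inv! (suc q) * ι (suc q) ≡ inv! q
inv!-suc q = recip-unique (q !) {{q !≢0}} (begin
  (inv! (suc q) * ι (suc q)) * ι (q !)   ≡⟨ *-assoc (inv! (suc q)) _ _ ⟩
  inv! (suc q) * (ι (suc q) * ι (q !))   ≡⟨ cong (inv! (suc q) *_) (ι-* (suc q) (q !)) ⟨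
  inv! (suc q) * ι (suc q !)             ≡⟨ recip-inverseˡ (suc q !) {{suc q !≢0}} ⟩
  1ℚ                                     ∎)
  where open ≡-Reasoning

a-zero : ∀ n → a 0 n ≡ one n
a-zero n = *-identityˡ (one n)

a-suc-0 : ∀ q → a (suc q) 0 ≡ 0ℚ
a-suc-0 q = trans (cong (inv! (suc q) *_) (trans (+-identityˡ _) (*-zeroˡ ((negLog1m ^ₛ q) 0))))
                  (*-zeroʳ (inv! (suc q)))

∂-a-suc : ∀ q n → ∂ (a (suc q)) n ≡ a q n
∂-a-suc q n = begin
  ι (suc n) * (c * L^[1+q] (suc n)) - ι n * (c * L^[1+q] n)  ≡⟨ lem (ι (suc n)) (ι n) c _ _ ⟩
  c * ∂ L^[1+q] n                                            ≡⟨ cong (c *_) (∂-negLog1m^suc q n) ⟩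
  c * (ι (suc q) * (negLog1m ^ₛ q) n)                        ≡⟨ *-assoc c _ _ ⟨
  (c * ι (suc q)) * (negLog1m ^ₛ q) n                        ≡⟨ cong (_* (negLog1m ^ₛ q) n) (inv!-suc q) ⟩
  a q n                                                      ∎
  where
  open ≡-Reasoning
  c = inv! (suc q)
  L^[1+q] = negLog1m ^ₛ suc q
  lem : ∀ u v c x y → u * (c * x) - v * (c * y) ≡ c * (u * x - v * y)
  lem = solve-∀ ℚ-ring

a-recurrence : ∀ q n → ι (suc n) * a (suc q) (suc n) ≡ ι n * a (suc q) n + a q n
a-recurrence q n = trans (lem (ι (suc n) * a (suc q) (suc n)) (ι n * a (suc q) n))
                         (cong (λ z → ι n * a (suc q) n + z) (∂-a-suc q n))
  where lem : ∀ x y → x ≡ y + (x - y)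
        lem = solve-∀ ℚ-ring

ι[1+n]*x≥0⇒x≥0 : ∀ n {x} → 0ℚ ≤ ι (suc n) * x → 0ℚ ≤ x
ι[1+n]*x≥0⇒x≥0 n 0≤nx = ι[1+n]-*-cancelˡ-≤ n (≤-trans (≤-reflexive (*-zeroʳ (ι (suc n)))) 0≤nx)

a-≥0 : ∀ q n → 0ℚ ≤ a q n
a-≥0 zero    zero    = ι-≥0 1
a-≥0 zero    (suc n) = ≤-reflexive (sym (a-zero (suc n)))
a-≥0 (suc q) zero    = ≤-reflexive (sym (a-suc-0 q))
a-≥0 (suc q) (suc n) = ι[1+n]*x≥0⇒x≥0 n (subst (0ℚ ≤_) (sym (a-recurrence q n))
  (+-≥0 (*-≥0 (ι-≥0 n) (a-≥0 (suc q) n)) (a-≥0 q n)))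

a-below : ∀ {n q} → n ℕ.< q → a q n ≡ 0ℚ
a-below {zero}  {suc q} _         = a-suc-0 q
a-below {suc n} {suc q} (s≤s n<q) = ι[1+n]-*-cancelˡ-≡ n (begin
  ι (suc n) * a (suc q) (suc n)      ≡⟨ a-recurrence q n ⟩
  ι n * a (suc q) n + a q n          ≡⟨ cong₂ (λ u v → ι n * u + v) (a-below (ℕ.m<n⇒m<1+n n<q)) (a-below n<q) ⟩
  ι n * 0ℚ + 0ℚ                      ≡⟨ cong (_+ 0ℚ) (*-zeroʳ (ι n)) ⟩
  0ℚ                                 ≡⟨ *-zeroʳ (ι (suc n)) ⟨
  ι (suc n) * 0ℚ                     ∎)
  where open ≡-Reasoning

w : ℕ → ℕ → ℚ
w k n = recip (suc n ^ suc k) {{m^n≢0 (suc n) (suc k)}}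

term≡a*w : ∀ q k n → term q k n ≡ a q n * w k n
term≡a*w q k n = begin
  (ι (n !) * a q n) * (inv! n * w k n)  ≡⟨ lem (ι (n !)) (a q n) (inv! n) (w k n) ⟩
  (ι (n !) * inv! n) * (a q n * w k n)  ≡⟨ cong (_* (a q n * w k n)) (ι[n!]*inv!≡1 n) ⟩
  1ℚ * (a q n * w k n)                  ≡⟨ *-identityˡ _ ⟩
  a q n * w k n                         ∎
  where
  open ≡-Reasoning
  lem : ∀ x y z u → (x * y) * (z * u) ≡ (x * z) * (y * u)
  lem = solve-∀ ℚ-ring

w-≥0 : ∀ k n → 0ℚ ≤ w k n
w-≥0 k n = recip-≥0 (suc n ^ suc k) {{m^n≢0 (suc n) (suc k)}}

w-zero : ∀ n → w 0 n ≡ recip (suc n)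
w-zero n = recip-unique (suc n) (trans (cong (λ m → w 0 n * ι m) (sym (ℕ.*-identityʳ (suc n))))
                                       (recip-inverseˡ (suc n ^ 1) {{m^n≢0 (suc n) 1}}))

ι[1+n]*w-zero : ∀ n → ι (suc n) * w 0 n ≡ 1ℚ
ι[1+n]*w-zero n = trans (cong (ι (suc n) *_) (w-zero n)) (recip-inverseʳ (suc n))

w≤w-zero : ∀ k n → w k n ≤ w 0 n
w≤w-zero k n = ≤-trans (recip-antimono-≤ {{_}} {{m^n≢0 (suc n) (suc k)}} 1+n≤[1+n]^[1+k])
                       (≤-reflexive (sym (w-zero n)))
  where
  1+n≤[1+n]^[1+k] : suc n ℕ.≤ suc n ^ suc k
  1+n≤[1+n]^[1+k] = ℕ.≤-trans (ℕ.≤-reflexive (sym (ℕ.*-identityʳ (suc n))))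
                              (ℕ.*-monoʳ-≤ (suc n) (ℕ.m^n>0 (suc n) k))

ι[1+n]*w-suc : ∀ k n → ι (suc n) * w (suc k) n ≡ w k n
ι[1+n]*w-suc k n = recip-unique (suc n ^ suc k) {{m^n≢0 (suc n) (suc k)}} (begin
  (ι (suc n) * w (suc k) n) * ι X   ≡⟨ lem (ι (suc n)) (w (suc k) n) (ι X) ⟩
  w (suc k) n * (ι (suc n) * ι X)   ≡⟨ cong (w (suc k) n *_) (ι-* (suc n) X) ⟨
  w (suc k) n * ι (suc n ℕ.* X)     ≡⟨ recip-inverseˡ (suc n ℕ.* X) {{m^n≢0 (suc n) (suc (suc k))}} ⟩
  1ℚ                                ∎)
  where
  open ≡-Reasoning
  X = suc n ^ suc k
  lem : ∀ x y z → (x * y) * z ≡ y * (x * z)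
  lem = solve-∀ ℚ-ring

-- wallis n = (2n choose n) / 4ⁿ.
wallis : ℕ → ℚ
wallis zero    = 1ℚ
wallis (suc n) = wallis n * (ι (suc (2 ℕ.* n)) * recip (suc (suc (2 ℕ.* n))))

wallis-≥0 : ∀ n → 0ℚ ≤ wallis n
wallis-≥0 zero    = ι-≥0 1
wallis-≥0 (suc n) = *-≥0 (wallis-≥0 n) (*-≥0 (ι-≥0 (suc (2 ℕ.* n))) (recip-≥0 (suc (suc (2 ℕ.* n)))))

wallis-suc : ∀ n → ι (suc (suc (2 ℕ.* n))) * wallis (suc n) ≡ ι (suc (2 ℕ.* n)) * wallis n
wallis-suc n = begin
  A * (wallis n * (B * recip (2+2n)))   ≡⟨ lem A (wallis n) B (recip (2+2n)) ⟩
  (B * wallis n) * (A * recip (2+2n))   ≡⟨ cong ((B * wallis n) *_) (recip-inverseʳ (2+2n)) ⟩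
  (B * wallis n) * 1ℚ                   ≡⟨ *-identityʳ _ ⟩
  B * wallis n                          ∎
  where
  open ≡-Reasoning
  2+2n = suc (suc (2 ℕ.* n))
  A = ι 2+2n
  B = ι (suc (2 ℕ.* n))
  lem : ∀ A p x y → A * (p * (x * y)) ≡ (x * p) * (A * y)
  lem = solve-∀ ℚ-ring

wallis-suc-≤ : ∀ n → wallis (suc n) ≤ wallis n
wallis-suc-≤ n = ≤-trans (*-monoˡ-≤-≥0 (wallis n) (wallis-≥0 n) ratio≤1) (≤-reflexive (*-identityʳ (wallis n)))
  where
  2+2n = suc (suc (2 ℕ.* n))
  ratio≤1 : ι (suc (2 ℕ.* n)) * recip 2+2n ≤ 1ℚ
  ratio≤1 = ≤-trans (*-monoʳ-≤-≥0 (recip 2+2n) (recip-≥0 2+2n) (ι-mono-≤ (ℕ.n≤1+n (suc (2 ℕ.* n)))))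
                    (≤-reflexive (recip-inverseʳ 2+2n))

wallis-antimono-≤ : ∀ {m n} → m ℕ.≤ n → wallis n ≤ wallis m
wallis-antimono-≤ m≤n = go (ℕ.≤⇒≤′ m≤n)
  where
  go : ∀ {m n} → m ℕ.≤′ n → wallis n ≤ wallis m
  go ℕ.≤′-refl                   = ≤-refl
  go {n = suc n} (ℕ.≤′-step m≤′n) = ≤-trans (wallis-suc-≤ n) (go m≤′n)

wallis²-bound : ∀ n → ι (suc (2 ℕ.* n)) * (wallis n * wallis n) ≤ 1ℚ
wallis²-bound zero    = ≤-refl
wallis²-bound (suc n) = ι[1+n]-*-cancelˡ-≤ (suc m) (ι[1+n]-*-cancelˡ-≤ (suc m) (begin
  A * (A * (C * (p′ * p′)))        ≡⟨ lem A C p′ ⟩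
  C * ((A * p′) * (A * p′))        ≡⟨ cong (λ z → C * (z * z)) (wallis-suc n) ⟩
  C * ((B * p) * (B * p))          ≡⟨ lem₂ C B p ⟩
  (C * B) * (B * (p * p))          ≤⟨ *-mono-≤-≥0 (*-≥0 (ι-≥0 (suc (suc m))) (ι-≥0 (suc (suc m))))
                                        (*-≥0 (ι-≥0 (suc m)) (*-≥0 (wallis-≥0 n) (wallis-≥0 n)))
                                        C*B≤A*A (wallis²-bound n) ⟩
  (A * A) * 1ℚ                     ≡⟨ *-assoc A A 1ℚ ⟩
  A * (A * 1ℚ)                     ∎))
  where
  open ≤-Reasoning
  m = 2 ℕ.* n
  A = ι (suc (suc m))
  B = ι (suc m)
  C = ι (suc (2 ℕ.* suc n))
  p = wallis n
  p′ = wallis (suc n)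
  lem : ∀ A C p → A * (A * (C * (p * p))) ≡ C * ((A * p) * (A * p))
  lem = solve-∀ ℚ-ring
  lem₂ : ∀ C B p → C * ((B * p) * (B * p)) ≡ (C * B) * (B * (p * p))
  lem₂ = solve-∀ ℚ-ring
  [3+m][1+m]≤[2+m]² : suc (2 ℕ.* suc n) ℕ.* suc m ℕ.≤ suc (suc m) ℕ.* suc (suc m)
  [3+m][1+m]≤[2+m]² = ℕ.≤-trans (ℕ.m≤m+n _ 1) (ℕ.≤-reflexive (eq n))
    where
    eq : ∀ n → suc (2 ℕ.* suc n) ℕ.* suc (2 ℕ.* n) ℕ.+ 1 ≡ suc (suc (2 ℕ.* n)) ℕ.* suc (suc (2 ℕ.* n))
    eq = ℕ-Solver.solve-∀
  C*B≤A*A : C * B ≤ A * A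
  C*B≤A*A = begin
    C * B                                  ≡⟨ ι-* (suc (2 ℕ.* suc n)) (suc m) ⟨
    ι (suc (2 ℕ.* suc n) ℕ.* suc m)        ≤⟨ ι-mono-≤ [3+m][1+m]≤[2+m]² ⟩
    ι (suc (suc m) ℕ.* suc (suc m))        ≡⟨ ι-* (suc (suc m)) (suc (suc m)) ⟩
    A * A                                  ∎

-- (n + 1) a (q + 1) (n + 1) = n a (q + 1) n + a q n ≤ 2^(q + 1) (n + ½) wallis n = 2^(q + 1) (n + 1) wallis (n + 1).
a≤2^q*wallis : ∀ q n → a q n ≤ ι (2 ^ q) * wallis n
a≤2^q*wallis zero    zero    = ≤-refl
a≤2^q*wallis zero    (suc n) = ≤-trans (≤-reflexive (a-zero (suc n))) (*-≥0 (ι-≥0 1) (wallis-≥0 (suc n)))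
a≤2^q*wallis (suc q) zero    = ≤-trans (≤-reflexive (a-suc-0 q)) (*-≥0 (ι-≥0 (2 ^ suc q)) (wallis-≥0 0))
a≤2^q*wallis (suc q) (suc n) = ι[1+n]-*-cancelˡ-≤ (suc m) (begin
  A * a (suc q) (suc n)                          ≡⟨ cong (_* a (suc q) (suc n)) A≡2*[1+n] ⟩
  (ι 2 * ι (suc n)) * a (suc q) (suc n)          ≡⟨ *-assoc (ι 2) (ι (suc n)) _ ⟩
  ι 2 * (ι (suc n) * a (suc q) (suc n))          ≡⟨ cong (ι 2 *_) (a-recurrence q n) ⟩
  ι 2 * (ι n * a (suc q) n + a q n)              ≤⟨ *-monoˡ-≤-≥0 (ι 2) (ι-≥0 2) (+-mono-≤
                                                      (*-monoˡ-≤-≥0 (ι n) (ι-≥0 n) (a≤2^q*wallis (suc q) n))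
                                                      (a≤2^q*wallis q n)) ⟩
  ι 2 * (ι n * (ι (2 ^ suc q) * p) + T * p)      ≡⟨ cong (λ z → ι 2 * (ι n * (z * p) + T * p)) (ι-* 2 (2 ^ q)) ⟩
  ι 2 * (ι n * ((ι 2 * T) * p) + T * p)          ≡⟨ lem (ι 2) (ι n) T p ⟩
  (ι 2 * T) * ((1ℚ + ι 2 * ι n) * p)             ≡⟨ cong₂ (λ u v → u * (v * p)) (ι-* 2 (2 ^ q)) B≡1+2*n ⟨
  ι (2 ^ suc q) * (ι (suc m) * p)                ≡⟨ cong (ι (2 ^ suc q) *_) (wallis-suc n) ⟨
  ι (2 ^ suc q) * (A * wallis (suc n))           ≡⟨ lem₂ (ι (2 ^ suc q)) A (wallis (suc n)) ⟩
  A * (ι (2 ^ suc q) * wallis (suc n))           ∎)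
  where
  open ≤-Reasoning
  m = 2 ℕ.* n
  A = ι (suc (suc m))
  T = ι (2 ^ q)
  p = wallis n
  A≡2*[1+n] : A ≡ ι 2 * ι (suc n)
  A≡2*[1+n] = trans (cong ι (sym (ℕ.*-suc 2 n))) (ι-* 2 (suc n))
  B≡1+2*n : ι (suc m) ≡ 1ℚ + ι 2 * ι n
  B≡1+2*n = trans (ι-suc m) (cong (1ℚ +_) (ι-* 2 n))
  lem : ∀ t x T p → t * (x * ((t * T) * p) + T * p) ≡ (t * T) * ((1ℚ + t * x) * p)
  lem = solve-∀ ℚ-ring
  lem₂ : ∀ x y z → x * (y * z) ≡ y * (x * z)
  lem₂ = solve-∀ ℚ-ring

G : ℕ → ℕ → ℚ
G q N = Σ< (suc q) (λ j → a j N)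

S : ℕ → ℕ → ℕ → ℚ
S q k N = Σ< N (λ n → a q n * w k n)

G-≥0 : ∀ q N → 0ℚ ≤ G q N
G-≥0 q N = Σ<-≥0 (suc q) (λ j _ → a-≥0 j N)

Σ<-2^j*x≤2^m*x : ∀ m {x} → 0ℚ ≤ x → Σ< m (λ j → ι (2 ^ j) * x) ≤ ι (2 ^ m) * x
Σ<-2^j*x≤2^m*x zero    0≤x = *-≥0 (ι-≥0 1) 0≤x
Σ<-2^j*x≤2^m*x (suc m) {x} 0≤x = begin
  Σ< m (λ j → ι (2 ^ j) * x) + ι (2 ^ m) * x  ≤⟨ +-monoˡ-≤ (ι (2 ^ m) * x) (Σ<-2^j*x≤2^m*x m 0≤x) ⟩
  ι (2 ^ m) * x + ι (2 ^ m) * x               ≡⟨ lem (ι (2 ^ m)) x ⟩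
  ((1ℚ + 1ℚ) * ι (2 ^ m)) * x                 ≡⟨ cong (λ c → (c * ι (2 ^ m)) * x) (ι-suc 1) ⟨
  (ι 2 * ι (2 ^ m)) * x                       ≡⟨ cong (_* x) (ι-* 2 (2 ^ m)) ⟨
  ι (2 ^ suc m) * x                           ∎
  where
  open ≤-Reasoning
  lem : ∀ t x → t * x + t * x ≡ ((1ℚ + 1ℚ) * t) * x
  lem = solve-∀ ℚ-ring

G≤2^[1+q]*wallis : ∀ q {M N} → M ℕ.≤ N → G q N ≤ ι (2 ^ suc q) * wallis M
G≤2^[1+q]*wallis q {M} {N} M≤N = begin
  G q N                             ≤⟨ Σ<-mono-≤ (suc q) (λ j _ → a≤2^q*wallis j N) ⟩
  Σ< (suc q) (λ j → ι (2 ^ j) * wallis N) ≤⟨ Σ<-2^j*x≤2^m*x (suc q) (wallis-≥0 N) ⟩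
  ι (2 ^ suc q) * wallis N          ≤⟨ *-monoˡ-≤-≥0 (ι (2 ^ suc q)) (ι-≥0 (2 ^ suc q)) (wallis-antimono-≤ M≤N) ⟩
  ι (2 ^ suc q) * wallis M          ∎
  where open ≤-Reasoning

G-zero : ∀ q → G q 0 ≡ 1ℚ
G-zero zero    = +-identityˡ 1ℚ
G-zero (suc q) = trans (cong₂ _+_ (G-zero q) (a-suc-0 q)) (+-identityʳ 1ℚ)

-- Summing a-recurrence over the number of cycles j ≤ q telescopes.
G-suc : ∀ q N → ι (suc N) * G q (suc N) ≡ ι (suc N) * G q N - a q N
G-suc zero N = begin
  ι (suc N) * (0ℚ + a 0 (suc N))        ≡⟨ cong (λ z → ι (suc N) * (0ℚ + z)) (a-zero (suc N)) ⟩
  ι (suc N) * (0ℚ + 0ℚ)                 ≡⟨ *-zeroʳ (ι (suc N)) ⟩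
  0ℚ                                    ≡⟨ ι*a-zero N ⟨
  ι N * a 0 N                           ≡⟨ lem (ι N) (a 0 N) ⟩
  (1ℚ + ι N) * (0ℚ + a 0 N) - a 0 N     ≡⟨ cong (λ z → z * (0ℚ + a 0 N) - a 0 N) (ι-suc N) ⟨
  ι (suc N) * (0ℚ + a 0 N) - a 0 N      ∎
  where
  open ≡-Reasoning
  lem : ∀ x y → x * y ≡ (1ℚ + x) * (0ℚ + y) - y
  lem = solve-∀ ℚ-ring
  ι*a-zero : ∀ n → ι n * a 0 n ≡ 0ℚ
  ι*a-zero zero    = *-zeroˡ (a 0 0)
  ι*a-zero (suc n) = trans (cong (ι (suc n) *_) (a-zero (suc n))) (*-zeroʳ (ι (suc n)))
G-suc (suc q) N = begin
  ι (suc N) * (G q (suc N) + a (suc q) (suc N))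
    ≡⟨ *-distribˡ-+ (ι (suc N)) _ _ ⟩
  ι (suc N) * G q (suc N) + ι (suc N) * a (suc q) (suc N)
    ≡⟨ cong₂ _+_ (G-suc q N) (a-recurrence q N) ⟩
  (ι (suc N) * G q N - a q N) + (ι N * a (suc q) N + a q N)
    ≡⟨ cong (λ z → (z * G q N - a q N) + (ι N * a (suc q) N + a q N)) (ι-suc N) ⟩
  ((1ℚ + ι N) * G q N - a q N) + (ι N * a (suc q) N + a q N)
    ≡⟨ lem (ι N) (G q N) (a q N) (a (suc q) N) ⟩
  (1ℚ + ι N) * (G q N + a (suc q) N) - a (suc q) N
    ≡⟨ cong (λ z → z * (G q N + a (suc q) N) - a (suc q) N) (ι-suc N) ⟨
  ι (suc N) * (G q N + a (suc q) N) - a (suc q) N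
    ∎
  where
  open ≡-Reasoning
  lem : ∀ x G A B → ((1ℚ + x) * G - A) + (x * B + A) ≡ (1ℚ + x) * (G + B) - B
  lem = solve-∀ ℚ-ring

S-zero+G≡1 : ∀ q N → S q 0 N + G q N ≡ 1ℚ
S-zero+G≡1 q zero    = trans (+-identityˡ (G q 0)) (G-zero q)
S-zero+G≡1 q (suc N) = begin
  (S q 0 N + a q N * w 0 N) + G q (suc N)   ≡⟨ +-assoc (S q 0 N) _ _ ⟩
  S q 0 N + (a q N * w 0 N + G q (suc N))   ≡⟨ cong (S q 0 N +_) step ⟩
  S q 0 N + G q N                           ≡⟨ S-zero+G≡1 q N ⟩
  1ℚ                                        ∎
  where
  open ≡-Reasoning
  lem : ∀ x y z → x * (y * z) ≡ y * (x * z)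
  lem = solve-∀ ℚ-ring
  lem₂ : ∀ x y → x + (y - x) ≡ y
  lem₂ = solve-∀ ℚ-ring
  step : a q N * w 0 N + G q (suc N) ≡ G q N
  step = ι[1+n]-*-cancelˡ-≡ N (begin
    ι (suc N) * (a q N * w 0 N + G q (suc N))
      ≡⟨ *-distribˡ-+ (ι (suc N)) _ _ ⟩
    ι (suc N) * (a q N * w 0 N) + ι (suc N) * G q (suc N)
      ≡⟨ cong₂ _+_ (trans (lem (ι (suc N)) (a q N) (w 0 N))
                          (trans (cong (a q N *_) (ι[1+n]*w-zero N)) (*-identityʳ (a q N))))
                   (G-suc q N) ⟩
    a q N + (ι (suc N) * G q N - a q N)
      ≡⟨ lem₂ (a q N) (ι (suc N) * G q N) ⟩
    ι (suc N) * G q N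
      ∎)

S-increment : ∀ q k M d → S q k (M ℕ.+ d) - S q k M ≡ Σ< d (λ i → a q (M ℕ.+ i) * w k (M ℕ.+ i))
S-increment q k M d = trans (cong (_- S q k M) (Σ<-split M d _)) (lem (S q k M) _)
  where lem : ∀ s x → (s + x) - s ≡ x
        lem = solve-∀ ℚ-ring

∣S-increment∣≤G : ∀ q k {M N} → M ℕ.≤ N → ∣ S q k N - S q k M ∣ ≤ G q M
∣S-increment∣≤G q k {M} {N} M≤N with d ← N ∸ M | refl ← sym (ℕ.m+[n∸m]≡n M≤N) = begin
  ∣ S q k (M ℕ.+ d) - S q k M ∣    ≡⟨ cong ∣_∣ (S-increment q k M d) ⟩
  ∣ tail k ∣                       ≡⟨ 0≤p⇒∣p∣≡p (Σ<-≥0 d (λ i _ → *-≥0 (a-≥0 q (M ℕ.+ i))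
                                                                     (w-≥0 k (M ℕ.+ i)))) ⟩
  tail k                           ≤⟨ Σ<-mono-≤ d (λ i _ → *-monoˡ-≤-≥0 (a q (M ℕ.+ i)) (a-≥0 q (M ℕ.+ i))
                                                               (w≤w-zero k (M ℕ.+ i))) ⟩
  tail 0                           ≤⟨ p≤p+q (tail 0) (G-≥0 q (M ℕ.+ d)) ⟩
  tail 0 + G q (M ℕ.+ d)           ≡⟨ cong (_+ G q (M ℕ.+ d)) (S-increment q 0 M d) ⟨
  (x - y) + G q (M ℕ.+ d)          ≡⟨ lem x y (G q (M ℕ.+ d)) ⟩
  (x + G q (M ℕ.+ d)) - y          ≡⟨ cong (_- y) (trans (S-zero+G≡1 q (M ℕ.+ d)) (sym (S-zero+G≡1 q M))) ⟩
  (y + G q M) - y                  ≡⟨ lem₂ y (G q M) ⟩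
  G q M                            ∎
  where
  open ≤-Reasoning
  tail : ℕ → ℚ
  tail k = Σ< d (λ i → a q (M ℕ.+ i) * w k (M ℕ.+ i))
  x = S q 0 (M ℕ.+ d)
  y = S q 0 M
  lem : ∀ x y g → (x - y) + g ≡ (x + g) - y
  lem = solve-∀ ℚ-ring
  lem₂ : ∀ y g → (y + g) - y ≡ g
  lem₂ = solve-∀ ℚ-ring

-- β n m = B(n + 1, m + 1) and γ n m = 1 / (n + m choose n).
β γ : ℕ → ℕ → ℚ
β n m = (ι (n !) * ι (m !)) * inv! (suc (n ℕ.+ m))
γ n m = (ι (n !) * ι (m !)) * inv! (n ℕ.+ m)

inv!≡[1+n]*inv![1+n] : ∀ n → inv! n ≡ ι (suc n) * inv! (suc n)
inv!≡[1+n]*inv![1+n] n = trans (sym (inv!-suc n)) (*-comm (inv! (suc n)) (ι (suc n)))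

γ≡[1+n+m]*β : ∀ n m → γ n m ≡ ι (suc (n ℕ.+ m)) * β n m
γ≡[1+n+m]*β n m = trans (cong ((ι (n !) * ι (m !)) *_) (inv!≡[1+n]*inv![1+n] (n ℕ.+ m)))
                        (lem (ι (n !) * ι (m !)) (ι (suc (n ℕ.+ m))) (inv! (suc (n ℕ.+ m))))
  where lem : ∀ F x y → F * (x * y) ≡ x * (F * y)
        lem = solve-∀ ℚ-ring

γ[n,1+m]≡[1+m]*β : ∀ n m → γ n (suc m) ≡ ι (suc m) * β n m
γ[n,1+m]≡[1+m]*β n m = begin
  (ι (n !) * ι (suc m !)) * inv! (n ℕ.+ suc m)
    ≡⟨ cong₂ (λ u v → (ι (n !) * u) * inv! v) (ι-* (suc m) (m !)) (ℕ.+-suc n m) ⟩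
  (ι (n !) * (ι (suc m) * ι (m !))) * inv! (suc (n ℕ.+ m))
    ≡⟨ lem (ι (n !)) (ι (suc m)) (ι (m !)) _ ⟩
  ι (suc m) * β n m
    ∎
  where
  open ≡-Reasoning
  lem : ∀ x y z u → (x * (y * z)) * u ≡ y * ((x * z) * u)
  lem = solve-∀ ℚ-ring

β-comm : ∀ n m → β n m ≡ β m n
β-comm n m = cong₂ _*_ (*-comm (ι (n !)) (ι (m !))) (cong (λ k → inv! (suc k)) (ℕ.+-comm n m))

γ-≥0 : ∀ n m → 0ℚ ≤ γ n m
γ-≥0 n m = *-≥0 (*-≥0 (ι-≥0 (n !)) (ι-≥0 (m !))) (recip-≥0 ((n ℕ.+ m) !) {{(n ℕ.+ m) !≢0}})

n!*m!≤[n+m]! : ∀ n m → n ! ℕ.* m ! ℕ.≤ (n ℕ.+ m) !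
n!*m!≤[n+m]! n m = ∣⇒≤ {{(n ℕ.+ m) !≢0}}
  (subst (λ k → n ! ℕ.* k ! ∣ (n ℕ.+ m) !) (ℕ.m+n∸m≡n n m) (k![n∸k]!∣n! (ℕ.m≤m+n n m)))

γ-≤1 : ∀ n m → γ n m ≤ 1ℚ
γ-≤1 n m = begin
  (ι (n !) * ι (m !)) * inv! (n ℕ.+ m)   ≡⟨ cong (_* inv! (n ℕ.+ m)) (ι-* (n !) (m !)) ⟨
  ι (n ! ℕ.* m !) * inv! (n ℕ.+ m)       ≤⟨ *-monoʳ-≤-≥0 (inv! (n ℕ.+ m)) (recip-≥0 _ {{(n ℕ.+ m) !≢0}})
                                              (ι-mono-≤ (n!*m!≤[n+m]! n m)) ⟩
  ι ((n ℕ.+ m) !) * inv! (n ℕ.+ m)       ≡⟨ ι[n!]*inv!≡1 (n ℕ.+ m) ⟩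
  1ℚ                                     ∎
  where open ≤-Reasoning

β[n,0]≡w-zero : ∀ n → β n 0 ≡ w 0 n
β[n,0]≡w-zero n = trans (recip-unique (suc n) (begin
  ((ι (n !) * 1ℚ) * inv! (suc (n ℕ.+ 0))) * ι (suc n)
    ≡⟨ cong (λ k → ((ι (n !) * 1ℚ) * inv! (suc k)) * ι (suc n)) (ℕ.+-identityʳ n) ⟩
  ((ι (n !) * 1ℚ) * inv! (suc n)) * ι (suc n)
    ≡⟨ lem (ι (n !)) (inv! (suc n)) (ι (suc n)) ⟩
  ι (n !) * (inv! (suc n) * ι (suc n))
    ≡⟨ cong (ι (n !) *_) (inv!-suc n) ⟩
  ι (n !) * inv! n
    ≡⟨ ι[n!]*inv!≡1 n ⟩
  1ℚ
    ∎)) (sym (w-zero n))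
  where
  open ≡-Reasoning
  lem : ∀ x y z → ((x * 1ℚ) * y) * z ≡ x * (y * z)
  lem = solve-∀ ℚ-ring

W : ℕ → ℕ → ℕ → ℚ
W k n M = Σ< M (λ m → a k m * β n m)

W-suc : ∀ k n M → ι (suc n) * W (suc k) n M ≡ W k n M - a (suc k) M * γ n M
W-suc k n zero = begin
  ι (suc n) * 0ℚ          ≡⟨ *-zeroʳ (ι (suc n)) ⟩
  0ℚ                      ≡⟨ cong (λ z → 0ℚ - z) (*-zeroˡ (γ n 0)) ⟨
  0ℚ - 0ℚ * γ n 0         ≡⟨ cong (λ z → 0ℚ - z * γ n 0) (a-suc-0 k) ⟨
  0ℚ - a (suc k) 0 * γ n 0 ∎
  where open ≡-Reasoning
W-suc k n (suc M) = begin
  ι (suc n) * (W (suc k) n M + a′ * β n M)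
    ≡⟨ *-distribˡ-+ (ι (suc n)) _ _ ⟩
  ι (suc n) * W (suc k) n M + ι (suc n) * (a′ * β n M)
    ≡⟨ cong (_+ ι (suc n) * (a′ * β n M)) (W-suc k n M) ⟩
  (W k n M - a′ * γ n M) + ι (suc n) * (a′ * β n M)
    ≡⟨ cong₂ (λ u v → (W k n M - a′ * u) + v * (a′ * β n M)) γ≡ (ι-suc n) ⟩
  (W k n M - a′ * ((1ℚ + (ι n + ι M)) * β n M)) + (1ℚ + ι n) * (a′ * β n M)
    ≡⟨ lem (W k n M) a′ (a k M) (ι n) (ι M) (β n M) ⟩
  (W k n M + a k M * β n M) - (ι M * a′ + a k M) * β n M
    ≡⟨ cong (λ z → (W k n M + a k M * β n M) - z * β n M) (a-recurrence k M) ⟨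
  (W k n M + a k M * β n M) - (ι (suc M) * a (suc k) (suc M)) * β n M
    ≡⟨ cong (λ z → (W k n M + a k M * β n M) - z) (lem₂ (ι (suc M)) (a (suc k) (suc M)) (β n M)) ⟩
  (W k n M + a k M * β n M) - a (suc k) (suc M) * (ι (suc M) * β n M)
    ≡⟨ cong (λ z → (W k n M + a k M * β n M) - a (suc k) (suc M) * z) (γ[n,1+m]≡[1+m]*β n M) ⟨
  (W k n M + a k M * β n M) - a (suc k) (suc M) * γ n (suc M)
    ∎
  where
  open ≡-Reasoning
  a′ = a (suc k) M
  γ≡ : γ n M ≡ (1ℚ + (ι n + ι M)) * β n M
  γ≡ = trans (γ≡[1+n+m]*β n M) (cong (_* β n M) (trans (ι-suc (n ℕ.+ M)) (cong (1ℚ +_) (ι-+ n M))))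
  lem : ∀ W a₁ a₀ x y b →
        (W - a₁ * ((1ℚ + (x + y)) * b)) + (1ℚ + x) * (a₁ * b) ≡ (W + a₀ * b) - (y * a₁ + a₀) * b
  lem = solve-∀ ℚ-ring
  lem₂ : ∀ x y z → (x * y) * z ≡ y * (x * z)
  lem₂ = solve-∀ ℚ-ring

W-zero : ∀ n M → W 0 n (suc M) ≡ w 0 n
W-zero n M = begin
  W 0 n (suc M)                                          ≡⟨ Σ<-suc M _ ⟩
  a 0 0 * β n 0 + Σ< M (λ m → a 0 (suc m) * β n (suc m))  ≡⟨ cong₂ _+_ (*-identityˡ (β n 0)) (Σ<-≡0 M a-zero-suc) ⟩
  β n 0 + 0ℚ                                             ≡⟨ +-identityʳ (β n 0) ⟩
  β n 0                                                  ≡⟨ β[n,0]≡w-zero n ⟩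
  w 0 n                                                  ∎
  where
  open ≡-Reasoning
  a-zero-suc : ∀ m → m ℕ.< M → a 0 (suc m) * β n (suc m) ≡ 0ℚ
  a-zero-suc m _ = trans (cong (_* β n (suc m)) (a-zero (suc m))) (*-zeroˡ (β n (suc m)))

ρ : ℕ → ℕ → ℕ → ℚ
ρ k n M = w k n - W k n M

ρ-suc : ∀ k n M → ι (suc n) * ρ (suc k) n M ≡ ρ k n M + a (suc k) M * γ n M
ρ-suc k n M = begin
  ι (suc n) * (w (suc k) n - W (suc k) n M)          ≡⟨ lem (ι (suc n)) (w (suc k) n) (W (suc k) n M) ⟩
  ι (suc n) * w (suc k) n - ι (suc n) * W (suc k) n M ≡⟨ cong₂ _-_ (ι[1+n]*w-suc k n) (W-suc k n M) ⟩
  w k n - (W k n M - a (suc k) M * γ n M)            ≡⟨ lem₂ (w k n) (W k n M) (a (suc k) M * γ n M) ⟩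
  ρ k n M + a (suc k) M * γ n M                      ∎
  where
  open ≡-Reasoning
  lem : ∀ x y z → x * (y - z) ≡ x * y - x * z
  lem = solve-∀ ℚ-ring
  lem₂ : ∀ x y z → x - (y - z) ≡ (x - y) + z
  lem₂ = solve-∀ ℚ-ring

ρ[0,n,1+M]≡0 : ∀ n M → ρ 0 n (suc M) ≡ 0ℚ
ρ[0,n,1+M]≡0 n M = trans (cong (λ z → w 0 n - z) (W-zero n M)) (+-inverseʳ (w 0 n))

ρ-≥0 : ∀ k n M → 0ℚ ≤ ρ k n M
ρ-≥0 zero    n zero    = ≤-trans (w-≥0 0 n) (≤-reflexive (sym (+-identityʳ (w 0 n))))
ρ-≥0 zero    n (suc M) = ≤-reflexive (sym (ρ[0,n,1+M]≡0 n M))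
ρ-≥0 (suc k) n M       = ι[1+n]*x≥0⇒x≥0 n (subst (0ℚ ≤_) (sym (ρ-suc k n M))
  (+-≥0 (ρ-≥0 k n M) (*-≥0 (a-≥0 (suc k) M) (γ-≥0 n M))))

ρ≤G*w-zero : ∀ k n M → ρ k n M ≤ G k M * w 0 n
ρ≤G*w-zero zero n zero = ≤-reflexive (begin-equality
  w 0 n + 0ℚ      ≡⟨ +-identityʳ (w 0 n) ⟩
  w 0 n           ≡⟨ *-identityˡ (w 0 n) ⟨
  1ℚ * w 0 n      ≡⟨ cong (_* w 0 n) (G-zero 0) ⟨
  G 0 0 * w 0 n   ∎)
  where open ≤-Reasoning
ρ≤G*w-zero zero n (suc M) = ≤-trans (≤-reflexive (ρ[0,n,1+M]≡0 n M)) (*-≥0 (G-≥0 0 (suc M)) (w-≥0 0 n))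
ρ≤G*w-zero (suc k) n M = ι[1+n]-*-cancelˡ-≤ n (begin
  ι (suc n) * ρ (suc k) n M                ≡⟨ ρ-suc k n M ⟩
  ρ k n M + a′ * γ n M                     ≤⟨ +-mono-≤ (ρ≤G*w-zero k n M)
                                                       (*-monoˡ-≤-≥0 a′ (a-≥0 (suc k) M) (γ-≤1 n M)) ⟩
  G k M * w 0 n + a′ * 1ℚ                  ≤⟨ +-mono-≤ (*-monoˡ-≤-≥0 (G k M) (G-≥0 k M) w-zero-≤1)
                                                       (≤-reflexive (*-identityʳ a′)) ⟩
  G k M * 1ℚ + a′                          ≡⟨ cong (_+ a′) (*-identityʳ (G k M)) ⟩
  G (suc k) M                              ≡⟨ *-identityʳ (G (suc k) M) ⟨
  G (suc k) M * 1ℚ                         ≡⟨ cong (G (suc k) M *_) (ι[1+n]*w-zero n) ⟨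
  G (suc k) M * (ι (suc n) * w 0 n)        ≡⟨ lem (G (suc k) M) (ι (suc n)) (w 0 n) ⟩
  ι (suc n) * (G (suc k) M * w 0 n)        ∎)
  where
  open ≤-Reasoning
  a′ = a (suc k) M
  w-zero-≤1 : w 0 n ≤ 1ℚ
  w-zero-≤1 = ≤-trans (≤-reflexive (w-zero n)) (recip-suc-≤1 n)
  lem : ∀ x y z → x * (y * z) ≡ y * (x * z)
  lem = solve-∀ ℚ-ring

U E : ℕ → ℕ → ℕ → ℚ
U q k N = Σ< N (λ n → a q n * W k n N)
E q k N = Σ< N (λ n → a q n * ρ k n N)

S≡U+E : ∀ q k N → S q k N ≡ U q k N + E q k N
S≡U+E q k N = trans (Σ<-ext N (λ n → lem (a q n) (w k n) (W k n N))) (Σ<-+ N _ _)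
  where lem : ∀ x y z → x * y ≡ x * z + x * (y - z)
        lem = solve-∀ ℚ-ring

U-comm : ∀ q k N → U q k N ≡ U k q N
U-comm q k N = begin
  Σ< N (λ n → a q n * Σ< N (λ m → a k m * β n m))    ≡⟨ Σ<-ext N (λ n → *-distribˡ-Σ< N (a q n) _) ⟩
  Σ< N (λ n → Σ< N (λ m → a q n * (a k m * β n m)))  ≡⟨ Σ<-ext N (λ n → Σ<-ext N (λ m → swap n m)) ⟩
  Σ< N (λ n → Σ< N (λ m → a k m * (a q n * β m n)))  ≡⟨ Σ<-comm N N (λ n m → a k m * (a q n * β m n)) ⟩
  Σ< N (λ m → Σ< N (λ n → a k m * (a q n * β m n)))  ≡⟨ Σ<-ext N (λ m → *-distribˡ-Σ< N (a k m) _) ⟨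
  Σ< N (λ m → a k m * Σ< N (λ n → a q n * β m n))    ∎
  where
  open ≡-Reasoning
  lem : ∀ x y z → x * (y * z) ≡ y * (x * z)
  lem = solve-∀ ℚ-ring
  swap : ∀ n m → a q n * (a k m * β n m) ≡ a k m * (a q n * β m n)
  swap n m = trans (cong (λ z → a q n * (a k m * z)) (β-comm n m)) (lem (a q n) (a k m) (β m n))

E-≥0 : ∀ q k N → 0ℚ ≤ E q k N
E-≥0 q k N = Σ<-≥0 N (λ n _ → *-≥0 (a-≥0 q n) (ρ-≥0 k n N))

E≤G : ∀ q k N → E q k N ≤ G k N
E≤G q k N = begin
  Σ< N (λ n → a q n * ρ k n N)            ≤⟨ Σ<-mono-≤ N (λ n _ → *-monoˡ-≤-≥0 (a q n) (a-≥0 q n)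
                                                                               (ρ≤G*w-zero k n N)) ⟩
  Σ< N (λ n → a q n * (G k N * w 0 n))    ≡⟨ Σ<-ext N (λ n → lem (a q n) (G k N) (w 0 n)) ⟩
  Σ< N (λ n → G k N * (a q n * w 0 n))    ≡⟨ *-distribˡ-Σ< N (G k N) _ ⟨
  G k N * S q 0 N                         ≤⟨ *-monoˡ-≤-≥0 (G k N) (G-≥0 k N) S-zero≤1 ⟩
  G k N * 1ℚ                              ≡⟨ *-identityʳ (G k N) ⟩
  G k N                                   ∎
  where
  open ≤-Reasoning
  lem : ∀ x y z → x * (y * z) ≡ y * (x * z)
  lem = solve-∀ ℚ-ring
  S-zero≤1 : S q 0 N ≤ 1ℚ
  S-zero≤1 = ≤-trans (p≤p+q (S q 0 N) (G-≥0 q N)) (≤-reflexive (S-zero+G≡1 q N))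

-- Both S q k N and S k q N differ from the symmetric double sum U q k N by at most one G.
∣S-S∣≤G+G : ∀ q k N → ∣ S q k N - S k q N ∣ ≤ G k N + G q N
∣S-S∣≤G+G q k N = begin
  ∣ S q k N - S k q N ∣            ≡⟨ cong ∣_∣ (cong₂ _-_ (S≡U+E q k N) (trans (S≡U+E k q N)
                                                  (cong (_+ E k q N) (sym (U-comm q k N))))) ⟩
  ∣ (u + E q k N) - (u + E k q N) ∣ ≡⟨ cong ∣_∣ (lem u (E q k N) (E k q N)) ⟩
  ∣ E q k N - E k q N ∣            ≤⟨ ∣p-q∣≤∣p∣+∣q∣ (E q k N) (E k q N) ⟩
  ∣ E q k N ∣ + ∣ E k q N ∣         ≡⟨ cong₂ _+_ (0≤p⇒∣p∣≡p (E-≥0 q k N))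
                                               (0≤p⇒∣p∣≡p (E-≥0 k q N)) ⟩
  E q k N + E k q N                ≤⟨ +-mono-≤ (E≤G q k N) (E≤G k q N) ⟩
  G k N + G q N                    ∎
  where
  open ≤-Reasoning
  u = U q k N
  lem : ∀ u x y → (u + x) - (u + y) ≡ x - y
  lem = solve-∀ ℚ-ring

archimedean : ∀ e → 0ℚ < e → Σ ℕ λ D → 1ℚ ≤ e * ι D
archimedean (mkℚ (ℤ.+ 0) _ _) 0<e with () ← ℚ.positive 0<e
archimedean (mkℚ -[1+ _ ] _ _) 0<e with () ← ℚ.positive 0<e
archimedean e@(mkℚ +[1+ n ] d _) _ = suc d , (begin
  1ℚ                             ≤⟨ ι-mono-≤ {1} {suc n} (s≤s z≤n) ⟩
  ι (suc n)                      ≡⟨ /-*-cancel (suc n) d ⟨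
  (ℤ.+ suc n / suc d) * ι (suc d) ≡⟨ cong (_* ι (suc d)) (↥p/↧p≡p e) ⟩
  e * ι (suc d)                  ∎)
  where open ≤-Reasoning

x*x<y*y⇒x<y : ∀ {x y} → 0ℚ ≤ y → x * x < y * y → x < y
x*x<y*y⇒x<y {x} {y} 0≤y xx<yy with x <? y
... | yes x<y = x<y
... | no  x≮y = contradiction (<-≤-trans xx<yy (*-mono-≤-≥0 (≤-trans 0≤y y≤x) 0≤y y≤x y≤x)) (<-irrefl refl)
  where y≤x = ≮⇒≥ x≮y

-- Since (2M + 1) wallis M² ≤ 1, it suffices that c² < (2M + 1) ε².
wallis-eventually-< : ∀ c ε → 0ℚ < ε → Σ ℕ λ M → ∀ n → M ℕ.≤ n → ι c * wallis n < ε
wallis-eventually-< c ε 0<ε =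
  M , λ n M≤n → ≤-<-trans (*-monoˡ-≤-≥0 (ι c) (ι-≥0 c) (wallis-antimono-≤ M≤n)) x<ε
  where
  e = ε * ε
  0<e : 0ℚ < e
  0<e = positive⁻¹ e {{pos*pos⇒pos ε {{ℚ.positive 0<ε}} ε {{ℚ.positive 0<ε}}}}
  D = proj₁ (archimedean e 0<e)
  1≤e*D = proj₂ (archimedean e 0<e)
  M = (c ℕ.* c) ℕ.* D
  B = ι (suc (2 ℕ.* M))
  x = ι c * wallis M
  B*x²≤c² : B * (x * x) ≤ ι (c ℕ.* c)
  B*x²≤c² = begin
    B * (x * x)                              ≡⟨ lem B (ι c) (wallis M) ⟩
    (ι c * ι c) * (B * (wallis M * wallis M)) ≤⟨ *-monoˡ-≤-≥0 (ι c * ι c) (*-≥0 (ι-≥0 c) (ι-≥0 c))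
                                                               (wallis²-bound M) ⟩
    (ι c * ι c) * 1ℚ                         ≡⟨ trans (*-identityʳ _) (sym (ι-* c c)) ⟩
    ι (c ℕ.* c)                              ∎
    where
    open ≤-Reasoning
    lem : ∀ B c p → B * ((c * p) * (c * p)) ≡ (c * c) * (B * (p * p))
    lem = solve-∀ ℚ-ring
  c²<B*e : ι (c ℕ.* c) < B * e
  c²<B*e = begin-strict
    ι (c ℕ.* c)                   ≡⟨ *-identityʳ (ι (c ℕ.* c)) ⟨
    ι (c ℕ.* c) * 1ℚ              ≤⟨ *-monoˡ-≤-≥0 (ι (c ℕ.* c)) (ι-≥0 (c ℕ.* c)) 1≤e*D ⟩
    ι (c ℕ.* c) * (e * ι D)       ≡⟨ lem (ι (c ℕ.* c)) e (ι D) ⟩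
    (ι (c ℕ.* c) * ι D) * e       ≡⟨ cong (_* e) (ι-* (c ℕ.* c) D) ⟨
    ι M * e                       ≡⟨ +-identityʳ (ι M * e) ⟨
    ι M * e + 0ℚ                  <⟨ +-monoʳ-< (ι M * e) 0<e ⟩
    ι M * e + e                   ≡⟨ lem₂ (ι M) e ⟩
    (1ℚ + ι M) * e                ≡⟨ cong (_* e) (ι-suc M) ⟨
    ι (suc M) * e                 ≤⟨ *-monoʳ-≤-≥0 e (<⇒≤ 0<e) (ι-mono-≤ (s≤s (ℕ.m≤n*m M 2))) ⟩
    B * e                         ∎
    where
    open ≤-Reasoning
    lem : ∀ a e d → a * (e * d) ≡ (a * d) * e
    lem = solve-∀ ℚ-ring
    lem₂ : ∀ m e → m * e + e ≡ (1ℚ + m) * e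
    lem₂ = solve-∀ ℚ-ring
  x<ε : x < ε
  x<ε = x*x<y*y⇒x<y (<⇒≤ 0<ε)
    (*-cancelˡ-<-nonNeg B {{ℚ.nonNegative (ι-≥0 (suc (2 ℕ.* M)))}} (≤-<-trans B*x²≤c² c²<B*e))

∣x-y∣≡∣y-x∣ : ∀ x y → ∣ x - y ∣ ≡ ∣ y - x ∣
∣x-y∣≡∣y-x∣ x y = trans (cong ∣_∣ (lem x y)) (∣-p∣≡∣p∣ (y - x))
  where lem : ∀ x y → x - y ≡ - (y - x)
        lem = solve-∀ ℚ-ring

∣x-z∣≤∣x-y∣+∣y-z∣ : ∀ x y z → ∣ x - z ∣ ≤ ∣ x - y ∣ + ∣ y - z ∣
∣x-z∣≤∣x-y∣+∣y-z∣ x y z =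
  ≤-trans (≤-reflexive (cong ∣_∣ (lem x y z))) (∣p+q∣≤∣p∣+∣q∣ (x - y) (y - z))
  where lem : ∀ x y z → x - z ≡ (x - y) + (y - z)
        lem = solve-∀ ℚ-ring

∣S-S∣≤2^[1+q]*wallis : ∀ q k {M m n} → M ℕ.≤ m → M ℕ.≤ n →
                       ∣ S q k m - S q k n ∣ ≤ ι (2 ^ suc q) * wallis M
∣S-S∣≤2^[1+q]*wallis q k {M} {m} {n} M≤m M≤n with ℕ.≤-total m n
... | inj₁ m≤n = begin
  ∣ S q k m - S q k n ∣        ≡⟨ ∣x-y∣≡∣y-x∣ (S q k m) (S q k n) ⟩
  ∣ S q k n - S q k m ∣        ≤⟨ ∣S-increment∣≤G q k m≤n ⟩
  G q m                        ≤⟨ G≤2^[1+q]*wallis q M≤m ⟩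
  ι (2 ^ suc q) * wallis M     ∎
  where open ≤-Reasoning
... | inj₂ n≤m = ≤-trans (∣S-increment∣≤G q k n≤m) (G≤2^[1+q]*wallis q M≤n)

partial≡S : ∀ q k N → partial q k N ≡ S q k (q ℕ.+ N)
partial≡S q k N = sym (begin
  S q k (q ℕ.+ N)                 ≡⟨ Σ<-split q N _ ⟩
  S q k q + tail                  ≡⟨ cong (_+ tail) (Σ<-≡0 q (λ i i<q → trans (cong (_* w k i) (a-below i<q))
                                                                              (*-zeroˡ (w k i)))) ⟩
  0ℚ + tail                       ≡⟨ +-identityˡ tail ⟩
  tail                            ≡⟨ Σ<-ext N (λ i → term≡a*w q k (q ℕ.+ i)) ⟨
  partial q k N                   ∎)
  where
  open ≡-Reasoning
  tail = Σ< N (λ i → a q (q ℕ.+ i) * w k (q ℕ.+ i))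

partial-cauchy : ∀ q k → Cauchy (partial q k)
partial-cauchy q k ε 0<ε = M , λ m n M≤m M≤n → begin-strict
  ∣ partial q k m - partial q k n ∣          ≡⟨ cong ∣_∣ (cong₂ _-_ (partial≡S q k m) (partial≡S q k n)) ⟩
  ∣ S q k (q ℕ.+ m) - S q k (q ℕ.+ n) ∣      ≤⟨ ∣S-S∣≤2^[1+q]*wallis q k (ℕ.≤-trans M≤m (ℕ.m≤n+m m q))
                                                                       (ℕ.≤-trans M≤n (ℕ.m≤n+m n q)) ⟩
  ι (2 ^ suc q) * wallis M                   <⟨ proj₂ small M ℕ.≤-refl ⟩
  ε                                          ∎
  where
  open ≤-Reasoning
  small = wallis-eventually-< (2 ^ suc q) ε 0<ε
  M = proj₁ small

∣S-S′∣≤2*[2^[1+q]+2^[1+k]]*wallis : ∀ q k n →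
  ∣ S q k (q ℕ.+ n) - S k q (k ℕ.+ n) ∣ ≤ ι (2 ℕ.* (2 ^ suc q ℕ.+ 2 ^ suc k)) * wallis n
∣S-S′∣≤2*[2^[1+q]+2^[1+k]]*wallis q k n = begin
  ∣ x - z ∣                            ≤⟨ ∣x-z∣≤∣x-y∣+∣y-z∣ x y z ⟩
  ∣ x - y ∣ + ∣ y - z ∣                 ≤⟨ +-monoʳ-≤ ∣ x - y ∣ (∣x-z∣≤∣x-y∣+∣y-z∣ y u z) ⟩
  ∣ x - y ∣ + (∣ y - u ∣ + ∣ u - z ∣)   ≤⟨ +-mono-≤ (∣S-S∣≤2^[1+q]*wallis q k n≤q+n n≤L)
                                                   (+-mono-≤ ∣y-u∣≤B+A (∣S-S∣≤2^[1+q]*wallis k q n≤L n≤k+n)) ⟩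
  A + ((B + A) + B)                    ≡⟨ lem (ι (2 ^ suc q)) (ι (2 ^ suc k)) (wallis n) ⟩
  ((1ℚ + 1ℚ) * (ι (2 ^ suc q) + ι (2 ^ suc k))) * wallis n
                                       ≡⟨ cong₂ (λ t s → (t * s) * wallis n) (ι-suc 1) (ι-+ (2 ^ suc q) (2 ^ suc k)) ⟨
  (ι 2 * ι (2 ^ suc q ℕ.+ 2 ^ suc k)) * wallis n
                                       ≡⟨ cong (_* wallis n) (ι-* 2 (2 ^ suc q ℕ.+ 2 ^ suc k)) ⟨
  ι (2 ℕ.* (2 ^ suc q ℕ.+ 2 ^ suc k)) * wallis n ∎
  where
  open ≤-Reasoning
  L = (q ℕ.+ n) ℕ.+ k
  n≤q+n = ℕ.m≤n+m n q
  n≤k+n = ℕ.m≤n+m n k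
  n≤L = ℕ.≤-trans n≤q+n (ℕ.m≤m+n (q ℕ.+ n) k)
  x = S q k (q ℕ.+ n)
  y = S q k L
  u = S k q L
  z = S k q (k ℕ.+ n)
  A = ι (2 ^ suc q) * wallis n
  B = ι (2 ^ suc k) * wallis n
  ∣y-u∣≤B+A : ∣ y - u ∣ ≤ B + A
  ∣y-u∣≤B+A = ≤-trans (∣S-S∣≤G+G q k L) (+-mono-≤ (G≤2^[1+q]*wallis k n≤L) (G≤2^[1+q]*wallis q n≤L))
  lem : ∀ a b w → a * w + ((b * w + a * w) + b * w) ≡ ((1ℚ + 1ℚ) * (a + b)) * w
  lem = solve-∀ ℚ-ring

partial-same-limit : ∀ q k → SameLimit (partial q k) (partial k q)
partial-same-limit q k ε 0<ε = proj₁ small , λ n M≤n → begin-strict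
  ∣ partial q k n - partial k q n ∣      ≡⟨ cong ∣_∣ (cong₂ _-_ (partial≡S q k n) (partial≡S k q n)) ⟩
  ∣ S q k (q ℕ.+ n) - S k q (k ℕ.+ n) ∣  ≤⟨ ∣S-S′∣≤2*[2^[1+q]+2^[1+k]]*wallis q k n ⟩
  ι c * wallis n                         <⟨ proj₂ small n M≤n ⟩
  ε                                      ∎
  where
  open ≤-Reasoning
  c = 2 ℕ.* (2 ^ suc q ℕ.+ 2 ^ suc k)
  small = wallis-eventually-< c ε 0<ε

corollary3 : (q k : ℕ) →
    Cauchy (partial q k) × Cauchy (partial k q) × SameLimit (partial q k) (partial k q)
corollary3 q k = partial-cauchy q k , partial-cauchy k q , partial-same-limit q k
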